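{- Let $n\in\mathbb{N}$. For all $\mathbf{x}\in\{0,1\}^n$ and $k\in[n]$, the following are equivalent: (i) $\partial_kF_n(\mathbf{x})>0$ and $x_k=0$, or $\partial_kF_n(\mathbf{x})<0$ and $x_k=1$; (ii) $s_n(\mathbf{x},k)\equiv x_k\pmod 2$ and $p_n(\mathbf{x},k)=1$.
   Context: For $n\in\mathbb{N}$ and $\mathbf{x}=(x_1,\dots,x_n)^\top\in\mathbb{R}^n$, set $x_0:=1$, $\alpha_{n,n+1}(\mathbf{x})=0$, and for $i\in[n]=\{1,\dots,n\}$: $\alpha_{n,i}(\mathbf{x})=x_i+(1-2x_i)\alpha_{n,i+1}(\mathbf{x})$ and $\beta_{n,i}(\mathbf{x})=2^i(x_i-x_i^2)\bigl(1-x_{i-1}+\sum_{j=1}^{i-2}x_j\bigr)$. Define $F_n(\mathbf{x})=\sum_{i=1}^n\bigl(2^{i-1}\alpha_{n,i}(\mathbf{x})-\beta_{n,i}(\mathbf{x})\bigr)$. For $k\in[n]$ define $p_n(\mathbf{x},k)=x_{k-1}\prod_{j=1}^{k-2}(1-x_j)$ (with $x_0:=1$, so $p_n(\mathbf{x},1)=1$) and $s_n(\mathbf{x},k)=\sum_{j=k+1}^nx_j$. -}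

module Defs where

open import Data.Nat using (ℕ; zero; suc; _∸_; _≡ᵇ_) renaming (_^_ to _^ℕ_)
open import Data.Integer using (ℤ; +_; _+_; _*_; -_; _-_)
open import Data.Bool using (Bool; true; false; if_then_else_)
open import Data.Fin using (Fin)
import Data.Fin as Fin
open import Data.List using (List; []; _∷_; map; foldr; upTo)

data Expr : Set where
  con  : ℤ → Expr
  var  : ℕ → Expr
  _⊕_  : Expr → Expr → Expr
  _⊗_  : Expr → Expr → Expr
  ⊖_   : Expr → Expr

infixl 6 _⊕_ _⊝_
infixl 7 _⊗_

_⊝_ : Expr → Expr → Expr
a ⊝ b = a ⊕ (⊖ b)

eval : (ℕ → ℤ) → Expr → ℤ
eval ρ (con c) = c
eval ρ (var j) = ρ j
eval ρ (a ⊕ b) = eval ρ a + eval ρ b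
eval ρ (a ⊗ b) = eval ρ a * eval ρ b
eval ρ (⊖ a)   = - eval ρ a

deriv : ℕ → Expr → Expr
deriv k (con c) = con (+ 0)
deriv k (var j) = if j ≡ᵇ k then con (+ 1) else con (+ 0)
deriv k (a ⊕ b) = deriv k a ⊕ deriv k b
deriv k (a ⊗ b) = (deriv k a ⊗ b) ⊕ (a ⊗ deriv k b)
deriv k (⊖ a)   = ⊖ deriv k a

-- the coordinate x_i, with the convention x_0 := 1
X : ℕ → Expr
X zero    = con (+ 1)
X (suc i) = var (suc i)

-- [a, b] = a, a+1, ..., b  (empty if b < a)
range : ℕ → ℕ → List ℕ
range a b = map (a Data.Nat.+_) (upTo (suc b ∸ a))

ΣE : ℕ → ℕ → (ℕ → Expr) → Expr
ΣE a b f = foldr _⊕_ (con (+ 0)) (map f (range a b))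

ΠE : ℕ → ℕ → (ℕ → Expr) → Expr
ΠE a b f = foldr _⊗_ (con (+ 1)) (map f (range a b))

-- α_{n,i}: αaux m i unfolds the recursion m times starting at index i, ending with 0
αaux : ℕ → ℕ → Expr
αaux zero    i = con (+ 0)
αaux (suc m) i = X i ⊕ ((con (+ 1) ⊝ (con (+ 2) ⊗ X i)) ⊗ αaux m (suc i))

α : ℕ → ℕ → Expr
α n i = αaux (suc n ∸ i) i

β : ℕ → ℕ → Expr
β n i = con (+ (2 ^ℕ i)) ⊗ (X i ⊝ (X i ⊗ X i))
          ⊗ ((con (+ 1) ⊝ X (i ∸ 1)) ⊕ ΣE 1 (i ∸ 2) X)

F : ℕ → Expr
F n = ΣE 1 n (λ i → (con (+ (2 ^ℕ (i ∸ 1))) ⊗ α n i) ⊝ β n i)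

pE : ℕ → ℕ → Expr
pE n k = X (k ∸ 1) ⊗ ΠE 1 (k ∸ 2) (λ j → con (+ 1) ⊝ X j)

sE : ℕ → ℕ → Expr
sE n k = ΣE (suc k) n X

-- a 0/1 point x ∈ {0,1}^n, coordinates x_1..x_n, as an environment (x_0 = 1, out of range = 0)
b2z : Bool → ℤ
b2z true  = + 1
b2z false = + 0

coord : ∀ {n} → (Fin n → Bool) → ℕ → ℤ
coord {zero}  x i       = + 0
coord {suc n} x zero    = b2z (x Fin.zero)
coord {suc n} x (suc i) = coord {n} (λ j → x (Fin.suc j)) i

env : ∀ {n} → (Fin n → Bool) → ℕ → ℤ
env x zero    = + 1
env x (suc i) = coord x i

xk : ∀ {n} → (Fin n → Bool) → ℕ → ℤ
xk x k = env x k

∂F : (n : ℕ) → (Fin n → Bool) → ℕ → ℤ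
∂F n x k = eval (env x) (deriv k (F n))

p : (n : ℕ) → (Fin n → Bool) → ℕ → ℤ
p n x k = eval (env x) (pE n k)

s : (n : ℕ) → (Fin n → Bool) → ℕ → ℤ
s n x k = eval (env x) (sE n k)

{-# OPTIONS --safe #-}
module Submission where

-- At a 0/1 point x_i - x_i² vanishes, so ∂_k β_i survives only for i = k, where it is
-- 2^k (1 - 2 x_k) c with c = 1 - x_{k-1} + Σ_{j ≤ k-2} x_j ≥ 0; and c = 0 exactly when p = 1.
-- On 0/1 points α_i is the parity of x_i + ⋯ + x_n, so ∂_k α_i = ±1 for i ≤ k, ∂_k α_i = 0 for i > k,
-- and ∂_k α_k = 1 - 2 α_{k+1}.  Hence ∂_k F_n = L + 2^{k-1} (1 - 2 α_{k+1}) - 2^k (1 - 2 x_k) c with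
-- |L| < 2^{k-1}.  If c = 0 the sign of ∂_k F_n is that of 1 - 2 α_{k+1}, i.e. it is read off the
-- parity of s; if c ≥ 1 the last term dominates and its sign is the opposite of the one (i) asks for.

open import Defs
open import Data.Nat using (ℕ; _≤_)
open import Data.Integer using (ℤ; +_; _<_; _-_)
open import Data.Integer.Divisibility using (_∣_)
open import Data.Bool using (Bool)
open import Data.Fin using (Fin)
open import Data.Product using (_×_)
open import Data.Sum using (_⊎_)
open import Function.Bundles using (_⇔_)
open import Relation.Binary.PropositionalEquality using (_≡_)

import Data.Nat as ℕ
open import Data.Nat using (zero; suc; _∸_; _^_; _≡ᵇ_; pred; NonZero)
import Data.Nat.Properties as ℕₚ
import Data.Nat.Divisibility as ℕ∣
open import Data.Integer using (+0; +[1+_]; -[1+_]; _+_; _*_; -_; ∣_∣; +<+; -<+; positive)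
import Data.Integer.Properties as ℤₚ
import Data.Integer.Divisibility.Signed as ℤ∣
open import Data.Integer.Tactic.RingSolver using (solve-∀)
open import Data.Bool using (true; false; T)
open import Data.Unit using (tt)
open import Data.Empty using (⊥-elim)
import Data.Fin as Fin
open import Data.List using (List; []; _∷_; _++_; map; foldr; applyUpTo)
import Data.List.Properties as Listₚ
open import Data.Product using (_,_)
open import Data.Product.Function.NonDependent.Propositional using (_×-⇔_)
open import Data.Sum using (inj₁; inj₂)
open import Function.Base using (_∘_)
open import Function.Bundles using (mk⇔)
open import Function.Construct.Composition using (_⇔-∘_)
open import Function.Construct.Identity using (⇔-id)
open import Relation.Binary.PropositionalEquality
  using (_≢_; refl; sym; trans; cong; cong₂; subst; subst₂; module ≡-Reasoning)

interval : ℕ → ℕ → List ℕ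
interval a zero    = []
interval a (suc m) = a ∷ interval (suc a) m

applyUpTo-interval : ∀ {f : ℕ → ℕ} a m → (∀ i → f i ≡ a ℕ.+ i) → applyUpTo f m ≡ interval a m
applyUpTo-interval a zero    f≗a+ = refl
applyUpTo-interval a (suc m) f≗a+ =
  cong₂ _∷_ (trans (f≗a+ 0) (ℕₚ.+-identityʳ a))
            (applyUpTo-interval (suc a) m (λ i → trans (f≗a+ (suc i)) (ℕₚ.+-suc a i)))

range≡interval : ∀ a b → range a b ≡ interval a (suc b ∸ a)
range≡interval a b = trans (Listₚ.map-upTo (a ℕ.+_) (suc b ∸ a)) (applyUpTo-interval a _ (λ _ → refl))

interval-++ : ∀ a m n → interval a (m ℕ.+ n) ≡ interval a m ++ interval (a ℕ.+ m) n
interval-++ a zero    n = cong (λ b → interval b n) (sym (ℕₚ.+-identityʳ a))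
interval-++ a (suc m) n =
  cong (a ∷_) (trans (interval-++ (suc a) m n) (cong (λ b → interval (suc a) m ++ interval b n) (sym (ℕₚ.+-suc a m))))

interval-split : ∀ {b m} .{{_ : NonZero b}} → b ≤ m →
                 interval 1 m ≡ interval 1 (pred b) ++ b ∷ interval (suc b) (m ∸ b)
interval-split {suc c} b≤m with ℕₚ.m≤n⇒∃[o]m+o≡n b≤m
... | r , refl = begin
  interval 1 (suc c ℕ.+ r)                               ≡⟨ cong (interval 1) (sym (ℕₚ.+-suc c r)) ⟩
  interval 1 (c ℕ.+ suc r)                               ≡⟨ interval-++ 1 c (suc r) ⟩
  interval 1 c ++ suc c ∷ interval (suc (suc c)) r       ≡⟨ cong (λ l → interval 1 c ++ suc c ∷ interval (suc (suc c)) l)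
                                                                 (sym (ℕₚ.m+n∸m≡n c r)) ⟩
  interval 1 c ++ suc c ∷ interval (suc (suc c)) (c ℕ.+ r ∸ c) ∎
  where open ≡-Reasoning

∑ : List ℕ → (ℕ → ℤ) → ℤ
∑ []       g = + 0
∑ (i ∷ is) g = g i + ∑ is g

∏ : List ℕ → (ℕ → ℤ) → ℤ
∏ []       g = + 1
∏ (i ∷ is) g = g i * ∏ is g

∑-++ : ∀ is js (g : ℕ → ℤ) → ∑ (is ++ js) g ≡ ∑ is g + ∑ js g
∑-++ []       js g = sym (ℤₚ.+-identityˡ (∑ js g))
∑-++ (i ∷ is) js g = trans (cong (λ z → g i + z) (∑-++ is js g)) (sym (ℤₚ.+-assoc (g i) (∑ is g) (∑ js g)))

∑-vanishing : ∀ a m (g : ℕ → ℤ) → (∀ i → a ≤ i → g i ≡ + 0) → ∑ (interval a m) g ≡ + 0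
∑-vanishing a zero    g g≡0 = refl
∑-vanishing a (suc m) g g≡0 =
  cong₂ _+_ (g≡0 a ℕₚ.≤-refl) (∑-vanishing (suc a) m g (λ i a<i → g≡0 i (ℕₚ.<⇒≤ a<i)))

∣∑∣-geometric-bound : ∀ a m (g : ℕ → ℤ) → (∀ i → a ℕ.< i → i ≤ a ℕ.+ m → ∣ g i ∣ ≤ 2 ^ (i ∸ 1)) →
                      2 ^ a ℕ.+ ∣ ∑ (interval (suc a) m) g ∣ ≤ 2 ^ (a ℕ.+ m)
∣∑∣-geometric-bound a zero g _ =
  ℕₚ.≤-reflexive (trans (ℕₚ.+-identityʳ (2 ^ a)) (cong (2 ^_) (sym (ℕₚ.+-identityʳ a))))
∣∑∣-geometric-bound a (suc m) g ∣g∣≤ = begin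
  2 ^ a ℕ.+ ∣ g (suc a) + S ∣              ≤⟨ ℕₚ.+-monoʳ-≤ (2 ^ a) (ℤₚ.∣i+j∣≤∣i∣+∣j∣ (g (suc a)) S) ⟩
  2 ^ a ℕ.+ (∣ g (suc a) ∣ ℕ.+ ∣ S ∣)      ≤⟨ ℕₚ.+-monoʳ-≤ (2 ^ a) (ℕₚ.+-monoˡ-≤ ∣ S ∣ ∣g[1+a]∣≤) ⟩
  2 ^ a ℕ.+ (2 ^ a ℕ.+ ∣ S ∣)              ≡⟨ sym (ℕₚ.+-assoc (2 ^ a) (2 ^ a) ∣ S ∣) ⟩
  2 ^ a ℕ.+ 2 ^ a ℕ.+ ∣ S ∣                ≡⟨ cong (λ z → 2 ^ a ℕ.+ z ℕ.+ ∣ S ∣) (sym (ℕₚ.+-identityʳ (2 ^ a))) ⟩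
  2 ^ suc a ℕ.+ ∣ S ∣                      ≤⟨ ∣∑∣-geometric-bound (suc a) m g ∣g∣≤′ ⟩
  2 ^ (suc a ℕ.+ m)                        ≡⟨ cong (2 ^_) (sym (ℕₚ.+-suc a m)) ⟩
  2 ^ (a ℕ.+ suc m)                        ∎
  where
  open ℕₚ.≤-Reasoning
  S = ∑ (interval (suc (suc a)) m) g
  ∣g[1+a]∣≤ : ∣ g (suc a) ∣ ≤ 2 ^ a
  ∣g[1+a]∣≤ = ∣g∣≤ (suc a) ℕₚ.≤-refl (ℕₚ.≤-trans (ℕ.s≤s (ℕₚ.m≤m+n a m)) (ℕₚ.≤-reflexive (sym (ℕₚ.+-suc a m))))
  ∣g∣≤′ : ∀ i → suc a ℕ.< i → i ≤ suc a ℕ.+ m → ∣ g i ∣ ≤ 2 ^ (i ∸ 1)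
  ∣g∣≤′ i 1+a<i i≤ = ∣g∣≤ i (ℕₚ.<-trans (ℕₚ.n<1+n a) 1+a<i) (ℕₚ.≤-trans i≤ (ℕₚ.≤-reflexive (sym (ℕₚ.+-suc a m))))

eval-foldr-⊕ : ∀ ρ (f : ℕ → Expr) is → eval ρ (foldr _⊕_ (con (+ 0)) (map f is)) ≡ ∑ is (eval ρ ∘ f)
eval-foldr-⊕ ρ f []       = refl
eval-foldr-⊕ ρ f (i ∷ is) = cong (λ z → eval ρ (f i) + z) (eval-foldr-⊕ ρ f is)

eval-foldr-⊗ : ∀ ρ (f : ℕ → Expr) is → eval ρ (foldr _⊗_ (con (+ 1)) (map f is)) ≡ ∏ is (eval ρ ∘ f)
eval-foldr-⊗ ρ f []       = refl
eval-foldr-⊗ ρ f (i ∷ is) = cong (λ z → eval ρ (f i) * z) (eval-foldr-⊗ ρ f is)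

eval-ΣE : ∀ ρ a b f → eval ρ (ΣE a b f) ≡ ∑ (interval a (suc b ∸ a)) (eval ρ ∘ f)
eval-ΣE ρ a b f = trans (eval-foldr-⊕ ρ f (range a b)) (cong (λ is → ∑ is (eval ρ ∘ f)) (range≡interval a b))

eval-ΠE : ∀ ρ a b f → eval ρ (ΠE a b f) ≡ ∏ (interval a (suc b ∸ a)) (eval ρ ∘ f)
eval-ΠE ρ a b f = trans (eval-foldr-⊗ ρ f (range a b)) (cong (λ is → ∏ is (eval ρ ∘ f)) (range≡interval a b))

deriv-foldr-⊕ : ∀ k (f : ℕ → Expr) is →
                deriv k (foldr _⊕_ (con (+ 0)) (map f is)) ≡ foldr _⊕_ (con (+ 0)) (map (deriv k ∘ f) is)
deriv-foldr-⊕ k f []       = refl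
deriv-foldr-⊕ k f (i ∷ is) = cong (deriv k (f i) ⊕_) (deriv-foldr-⊕ k f is)

eval-deriv-ΣE : ∀ ρ k a b f →
                eval ρ (deriv k (ΣE a b f)) ≡ ∑ (interval a (suc b ∸ a)) (λ i → eval ρ (deriv k (f i)))
eval-deriv-ΣE ρ k a b f = trans (cong (eval ρ) (deriv-foldr-⊕ k f (range a b))) (eval-ΣE ρ a b (deriv k ∘ f))

deriv-X-self : ∀ k .{{_ : NonZero k}} → deriv k (X k) ≡ con (+ 1)
deriv-X-self (suc k) with k ≡ᵇ k | ℕₚ.≡⇒≡ᵇ k k refl
... | true  | _  = refl
... | false | ()

deriv-X-other : ∀ {i k} → i ≢ k → deriv k (X i) ≡ con (+ 0)
deriv-X-other {zero}      _   = refl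
deriv-X-other {suc i} {k} i≢k with suc i ≡ᵇ k in eq
... | true  = ⊥-elim (i≢k (ℕₚ.≡ᵇ⇒≡ (suc i) k (subst T (sym eq) tt)))
... | false = refl

IsBit : ℤ → Set
IsBit z = z ≡ + 0 ⊎ z ≡ + 1

IsUnit : ℤ → Set
IsUnit z = z ≡ + 1 ⊎ z ≡ -[1+ 0 ]

complement-bit : ∀ {y} → IsBit y → IsBit (+ 1 - y)
complement-bit (inj₁ refl) = inj₂ refl
complement-bit (inj₂ refl) = inj₁ refl

xor-bit : ∀ {y a} → IsBit y → IsBit a → IsBit (y + (+ 1 - + 2 * y) * a)
xor-bit (inj₁ refl) (inj₁ refl) = inj₁ refl
xor-bit (inj₁ refl) (inj₂ refl) = inj₂ refl
xor-bit (inj₂ refl) (inj₁ refl) = inj₂ refl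
xor-bit (inj₂ refl) (inj₂ refl) = inj₁ refl

bit-x-x²≡0 : ∀ {y} → IsBit y → y - y * y ≡ + 0
bit-x-x²≡0 (inj₁ refl) = refl
bit-x-x²≡0 (inj₂ refl) = refl

bit≢complement : ∀ {y} → IsBit y → y ≢ + 1 - y
bit≢complement (inj₁ refl) ()
bit≢complement (inj₂ refl) ()

bits-even-difference⇒≡ : ∀ {a y} → IsBit a → IsBit y → + 2 ℤ∣.∣ a - y → a ≡ y
bits-even-difference⇒≡ (inj₁ refl) (inj₁ refl) _   = refl
bits-even-difference⇒≡ (inj₁ refl) (inj₂ refl) 2∣a-y with () ← ℕ∣.∣1⇒≡1 (ℤ∣.∣⇒∣ᵤ 2∣a-y)
bits-even-difference⇒≡ (inj₂ refl) (inj₁ refl) 2∣a-y with () ← ℕ∣.∣1⇒≡1 (ℤ∣.∣⇒∣ᵤ 2∣a-y)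
bits-even-difference⇒≡ (inj₂ refl) (inj₂ refl) _   = refl

unit-of-bit : ∀ {a} → IsBit a → IsUnit (+ 1 - + 2 * a)
unit-of-bit (inj₁ refl) = inj₁ refl
unit-of-bit (inj₂ refl) = inj₂ refl

unit-* : ∀ {u v} → IsUnit u → IsUnit v → IsUnit (u * v)
unit-* (inj₁ refl) (inj₁ refl) = inj₁ refl
unit-* (inj₁ refl) (inj₂ refl) = inj₂ refl
unit-* (inj₂ refl) (inj₁ refl) = inj₂ refl
unit-* (inj₂ refl) (inj₂ refl) = inj₁ refl

∣n*unit∣≡n : ∀ n {u} → IsUnit u → ∣ + n * u ∣ ≡ n
∣n*unit∣≡n n {u} u-unit = begin
  ∣ + n * u ∣      ≡⟨ ℤₚ.∣i*j∣≡∣i∣*∣j∣ (+ n) u ⟩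
  n ℕ.* ∣ u ∣      ≡⟨ cong (n ℕ.*_) (∣unit∣ u-unit) ⟩
  n ℕ.* 1          ≡⟨ ℕₚ.*-identityʳ n ⟩
  n                ∎
  where
  open ≡-Reasoning
  ∣unit∣ : ∀ {u} → IsUnit u → ∣ u ∣ ≡ 1
  ∣unit∣ (inj₁ refl) = refl
  ∣unit∣ (inj₂ refl) = refl

SignBit : ℤ → ℤ → Set
SignBit d b = (+ 0 < d × b ≡ + 0) ⊎ (d < + 0 × b ≡ + 1)

signBit-unique : ∀ {d b c} → SignBit d b → SignBit d c → b ≡ c
signBit-unique (inj₁ (_ , b≡0))   (inj₁ (_ , c≡0))   = trans b≡0 (sym c≡0)
signBit-unique (inj₂ (_ , b≡1))   (inj₂ (_ , c≡1))   = trans b≡1 (sym c≡1)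
signBit-unique (inj₁ (0<d , _))   (inj₂ (d<0 , _))   = ⊥-elim (ℤₚ.<-asym 0<d d<0)
signBit-unique (inj₂ (d<0 , _))   (inj₁ (0<d , _))   = ⊥-elim (ℤₚ.<-asym 0<d d<0)

signBit-unit : ∀ {a} → IsBit a → SignBit (+ 1 - + 2 * a) a
signBit-unit (inj₁ refl) = inj₁ (+<+ (ℕ.s≤s ℕ.z≤n) , refl)
signBit-unit (inj₂ refl) = inj₂ (-<+ , refl)

signBit-neg : ∀ {d b} → SignBit d b → SignBit (- d) (+ 1 - b)
signBit-neg (inj₁ (0<d , refl)) = inj₂ (ℤₚ.neg-mono-< 0<d , refl)
signBit-neg (inj₂ (d<0 , refl)) = inj₁ (ℤₚ.neg-mono-< d<0 , refl)

signBit-*-pos : ∀ {d b q} → SignBit d b → + 0 < q → SignBit (d * q) b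
signBit-*-pos {d} {q = q} (inj₁ (0<d , b≡0)) 0<q =
  inj₁ (subst (_< d * q) (ℤₚ.*-zeroʳ d) (ℤₚ.*-monoˡ-<-pos d {{positive 0<d}} 0<q) , b≡0)
signBit-*-pos {d} {q = q} (inj₂ (d<0 , b≡1)) 0<q =
  inj₂ (subst (d * q <_) (ℤₚ.*-zeroˡ q) (ℤₚ.*-monoʳ-<-pos q {{positive 0<q}} d<0) , b≡1)

0<i+n : ∀ i {n} → ∣ i ∣ ℕ.< n → + 0 < i + + n
0<i+n (+ m)      {n} ∣i∣<n = +<+ (ℕₚ.<-≤-trans (ℕₚ.≤-<-trans ℕ.z≤n ∣i∣<n) (ℕₚ.m≤n+m n m))
0<i+n -[1+ m ]   {n} ∣i∣<n = subst (+ 0 <_) (sym (ℤₚ.⊖-≥ (ℕₚ.<⇒≤ ∣i∣<n))) (+<+ (ℕₚ.m<n⇒0<n∸m ∣i∣<n))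

0<r+B*h : ∀ r {h} B → ∣ r ∣ ℕ.< B → + 0 < h → + 0 < r + + B * h
0<r+B*h r {+[1+ n ]} B ∣r∣<B _ =
  subst (λ z → + 0 < r + z) (ℤₚ.pos-* B (suc n)) (0<i+n r (ℕₚ.<-≤-trans ∣r∣<B (ℕₚ.m≤m*n B (suc n))))
0<r+B*h _ {+0}       B _ (+<+ ())
0<r+B*h _ { -[1+ _ ]} B _ ()

r+B*h<0 : ∀ r {h} B → ∣ r ∣ ℕ.< B → h < + 0 → r + + B * h < + 0
r+B*h<0 r {h} B ∣r∣<B h<0 =
  ℤₚ.neg-cancel-< {+ 0} {r + + B * h} (subst (+ 0 <_) (negate r (+ B) h) (0<r+B*h (- r) B ∣-r∣<B (ℤₚ.neg-mono-< h<0)))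
  where
  negate : ∀ r c h → - r + c * - h ≡ - (r + c * h)
  negate = solve-∀
  ∣-r∣<B : ∣ - r ∣ ℕ.< B
  ∣-r∣<B = subst (ℕ._< B) (sym (ℤₚ.∣-i∣≡∣i∣ r)) ∣r∣<B

signBit-dominant : ∀ r {h b} B → ∣ r ∣ ℕ.< B → SignBit h b → SignBit (r + + B * h) b
signBit-dominant r B ∣r∣<B (inj₁ (0<h , b≡0)) = inj₁ (0<r+B*h r B ∣r∣<B 0<h , b≡0)
signBit-dominant r B ∣r∣<B (inj₂ (h<0 , b≡1)) = inj₂ (r+B*h<0 r B ∣r∣<B h<0 , b≡1)

ZeroIndicator : ℤ → ℤ → Set
ZeroIndicator P Z = (P ≡ + 1 × Z ≡ + 0) ⊎ (P ≡ + 0 × + 0 < Z)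

zeroIndicator-step : ∀ {c P Z} → IsBit c → ZeroIndicator P Z → ZeroIndicator ((+ 1 - c) * P) (c + Z)
zeroIndicator-step {P = P} {Z} (inj₁ refl) P≐Z =
  subst₂ ZeroIndicator (sym (ℤₚ.*-identityˡ P)) (sym (ℤₚ.+-identityˡ Z)) P≐Z
zeroIndicator-step (inj₂ refl) (inj₁ (_ , refl))                 = inj₂ (refl , +<+ (ℕ.s≤s ℕ.z≤n))
zeroIndicator-step (inj₂ refl) (inj₂ (_ , +<+ (ℕ.s≤s ℕ.z≤n)))    = inj₂ (refl , +<+ (ℕ.s≤s ℕ.z≤n))

bit-parity⇔ : ∀ s {a y} → + 2 ℤ∣.∣ s - a → IsBit a → IsBit y → (a ≡ y) ⇔ (+ 2 ∣ s - y)
bit-parity⇔ s {a} {y} 2∣s-a a-bit y-bit = mk⇔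
  (λ { refl → ℤ∣.∣⇒∣ᵤ 2∣s-a })
  (λ 2∣s-y → bits-even-difference⇒≡ a-bit y-bit
               (subst (+ 2 ℤ∣.∣_) (difference s a y) (ℤ∣.∣m∣n⇒∣m-n {+ 2} {s - y} (ℤ∣.∣ᵤ⇒∣ 2∣s-y) 2∣s-a)))
  where
  difference : ∀ s a y → (s - y) - (s - a) ≡ a - y
  difference = solve-∀

sign-criterion : ∀ {d a y P Q} L B → ∣ L ∣ ℕ.< B → IsBit a → IsBit y → ZeroIndicator P Q →
                 d ≡ L + (+ B * (+ 1 - + 2 * a) - + (2 ℕ.* B) * ((+ 1 - + 2 * y) * Q)) →
                 SignBit d y ⇔ (a ≡ y × P ≡ + 1)
sign-criterion {d} {a} {y} L B ∣L∣<B a-bit y-bit (inj₁ (P≡1 , refl)) d≡ =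
  mk⇔ (λ d∼y → signBit-unique d∼a d∼y , P≡1) (λ (a≡y , _) → subst (SignBit d) a≡y d∼a)
  where
  drop-Q : ∀ L Be M f → L + (Be - M * (f * + 0)) ≡ L + Be
  drop-Q = solve-∀
  d∼a : SignBit d a
  d∼a = subst (λ z → SignBit z a) (sym (trans d≡ (drop-Q L (+ B * (+ 1 - + 2 * a)) (+ (2 ℕ.* B)) (+ 1 - + 2 * y))))
              (signBit-dominant L B ∣L∣<B (signBit-unit a-bit))
sign-criterion {d} {a} {y} {Q = Q} L B ∣L∣<B a-bit y-bit (inj₂ (refl , 0<Q)) d≡ =
  mk⇔ (λ d∼y → ⊥-elim (bit≢complement y-bit (signBit-unique d∼y d∼1-y))) (λ { (_ , ()) })
  where
  regroup : ∀ L Be M fQ → L + (Be - M * fQ) ≡ (L + Be) + M * - fQ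
  regroup = solve-∀
  ∣L+Be∣<2B : ∣ L + + B * (+ 1 - + 2 * a) ∣ ℕ.< 2 ℕ.* B
  ∣L+Be∣<2B = begin-strict
    ∣ L + + B * (+ 1 - + 2 * a) ∣             ≤⟨ ℤₚ.∣i+j∣≤∣i∣+∣j∣ L (+ B * (+ 1 - + 2 * a)) ⟩
    ∣ L ∣ ℕ.+ ∣ + B * (+ 1 - + 2 * a) ∣        ≡⟨ cong (∣ L ∣ ℕ.+_) (∣n*unit∣≡n B (unit-of-bit a-bit)) ⟩
    ∣ L ∣ ℕ.+ B                               <⟨ ℕₚ.+-monoˡ-< B ∣L∣<B ⟩
    B ℕ.+ B                                   ≡⟨ cong (B ℕ.+_) (sym (ℕₚ.+-identityʳ B)) ⟩
    2 ℕ.* B                                   ∎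
    where open ℕₚ.≤-Reasoning
  d∼1-y : SignBit d (+ 1 - y)
  d∼1-y = subst (λ z → SignBit z (+ 1 - y)) (sym (trans d≡ (regroup L (+ B * (+ 1 - + 2 * a)) (+ (2 ℕ.* B)) ((+ 1 - + 2 * y) * Q))))
                (signBit-dominant (L + + B * (+ 1 - + 2 * a)) (2 ℕ.* B) ∣L+Be∣<2B (signBit-neg (signBit-*-pos (signBit-unit y-bit) 0<Q)))

b2z-bit : ∀ b → IsBit (b2z b)
b2z-bit true  = inj₂ refl
b2z-bit false = inj₁ refl

coord-bit : ∀ {n} (x : Fin n → Bool) i → IsBit (coord x i)
coord-bit {zero}  x i       = inj₁ refl
coord-bit {suc n} x zero    = b2z-bit (x Fin.zero)
coord-bit {suc n} x (suc i) = coord-bit (x ∘ Fin.suc) i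

env-bit : ∀ {n} (x : Fin n → Bool) j → IsBit (env x j)
env-bit x zero    = inj₂ refl
env-bit x (suc j) = coord-bit x j

module AtBitPoint (ρ : ℕ → ℤ) (ρ-bit : ∀ j → IsBit (ρ j)) where

  y : ℕ → ℤ
  y i = eval ρ (X i)

  y-bit : ∀ i → IsBit (y i)
  y-bit zero    = inj₂ refl
  y-bit (suc i) = ρ-bit (suc i)

  a : ℕ → ℕ → ℤ
  a m i = eval ρ (αaux m i)

  αaux-bit : ∀ m i → IsBit (a m i)
  αaux-bit zero    i = inj₁ refl
  αaux-bit (suc m) i = xor-bit (y-bit i) (αaux-bit m (suc i))

  αaux-parity : ∀ m i → + 2 ℤ∣.∣ ∑ (interval i m) y - a m i
  αaux-parity zero    i = ℤ∣.divides (+ 0) refl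
  αaux-parity (suc m) i =
    subst (+ 2 ℤ∣.∣_) (sym (regroup (y i) (∑ (interval (suc i) m) y) (a m (suc i))))
          (ℤ∣.∣m∣n⇒∣m+n (αaux-parity m (suc i)) (ℤ∣.∣m⇒∣m*n (y i * a m (suc i)) ℤ∣.∣-refl))
    where
    regroup : ∀ y s a → y + s - (y + (+ 1 - + 2 * y) * a) ≡ (s - a) + + 2 * (y * a)
    regroup = solve-∀

  sE-parity : ∀ n k → + 2 ℤ∣.∣ eval ρ (sE n k) - a (n ∸ k) (suc k)
  sE-parity n k = subst (λ s → + 2 ℤ∣.∣ s - a (n ∸ k) (suc k)) (sym (eval-ΣE ρ (suc k) n X)) (αaux-parity (n ∸ k) (suc k))

  ∏-complement-indicates-∑ : ∀ is → ZeroIndicator (∏ is (λ j → + 1 - y j)) (∑ is y)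
  ∏-complement-indicates-∑ []       = inj₁ (refl , refl)
  ∏-complement-indicates-∑ (i ∷ is) = zeroIndicator-step (y-bit i) (∏-complement-indicates-∑ is)

  βtail : ℕ → Expr
  βtail i = (con (+ 1) ⊝ X (i ∸ 1)) ⊕ ΣE 1 (i ∸ 2) X

  q : ℕ → ℤ
  q i = eval ρ (βtail i)

  pE-indicates-βtail : ∀ n k → ZeroIndicator (eval ρ (pE n k)) (q k)
  pE-indicates-βtail n k =
    subst₂ ZeroIndicator
      (cong₂ _*_ (complement-involutive (y (k ∸ 1))) (sym (eval-ΠE ρ 1 (k ∸ 2) (λ j → con (+ 1) ⊝ X j))))
      (cong (λ Z → (+ 1 - y (k ∸ 1)) + Z) (sym (eval-ΣE ρ 1 (k ∸ 2) X)))
      (zeroIndicator-step (complement-bit (y-bit (k ∸ 1))) (∏-complement-indicates-∑ (interval 1 (k ∸ 2))))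
    where
    complement-involutive : ∀ y → + 1 - (+ 1 - y) ≡ y
    complement-involutive = solve-∀

  module Derivative (k : ℕ) .{{_ : NonZero k}} where

    ∂ : Expr → ℤ
    ∂ e = eval ρ (deriv k e)

    ∂X-self : ∂ (X k) ≡ + 1
    ∂X-self = cong (eval ρ) (deriv-X-self k)

    ∂X-other : ∀ {i} → i ≢ k → ∂ (X i) ≡ + 0
    ∂X-other i≢k = cong (eval ρ) (deriv-X-other i≢k)

    ∂a : ℕ → ℕ → ℤ
    ∂a m i = ∂ (αaux m i)

    ∂αaux-step : ∀ m i → ∂a (suc m) i ≡ ∂ (X i) * (+ 1 - + 2 * a m (suc i)) + (+ 1 - + 2 * y i) * ∂a m (suc i)
    ∂αaux-step m i = product-rule (∂ (X i)) (y i) (a m (suc i)) (∂a m (suc i))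
      where
      -- the left-hand side is deriv followed by eval, unfolded literally
      product-rule : ∀ dx x u du → dx + ((+ 0 + - (+ 0 * x + + 2 * dx)) * u + (+ 1 + - (+ 2 * x)) * du)
                                   ≡ dx * (+ 1 - + 2 * u) + (+ 1 - + 2 * x) * du
      product-rule = solve-∀

    ∂αaux-above : ∀ m i → k ℕ.< i → ∂a m i ≡ + 0
    ∂αaux-above zero    i k<i = refl
    ∂αaux-above (suc m) i k<i = begin
      ∂a (suc m) i                                   ≡⟨ ∂αaux-step m i ⟩
      ∂ (X i) * e + f * ∂a m (suc i)                 ≡⟨ cong₂ (λ dx du → dx * e + f * du)
                                                            (∂X-other (ℕₚ.>⇒≢ k<i)) (∂αaux-above m (suc i) (ℕₚ.m<n⇒m<1+n k<i)) ⟩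
      + 0 * e + f * + 0                              ≡⟨ cong (λ z → + 0 + z) (ℤₚ.*-zeroʳ f) ⟩
      + 0                                            ∎
      where
      open ≡-Reasoning
      e = + 1 - + 2 * a m (suc i)
      f = + 1 - + 2 * y i

    ∂αaux-at : ∀ m → ∂a (suc m) k ≡ + 1 - + 2 * a m (suc k)
    ∂αaux-at m = begin
      ∂a (suc m) k                                   ≡⟨ ∂αaux-step m k ⟩
      ∂ (X k) * e + f * ∂a m (suc k)                 ≡⟨ cong₂ (λ dx du → dx * e + f * du) ∂X-self (∂αaux-above m (suc k) ℕₚ.≤-refl) ⟩
      + 1 * e + f * + 0                              ≡⟨ cong₂ _+_ (ℤₚ.*-identityˡ e) (ℤₚ.*-zeroʳ f) ⟩
      e + + 0                                        ≡⟨ ℤₚ.+-identityʳ e ⟩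
      e                                              ∎
      where
      open ≡-Reasoning
      e = + 1 - + 2 * a m (suc k)
      f = + 1 - + 2 * y k

    ∂αaux-below : ∀ m i → i ℕ.< k → ∂a (suc m) i ≡ (+ 1 - + 2 * y i) * ∂a m (suc i)
    ∂αaux-below m i i<k = begin
      ∂a (suc m) i                                   ≡⟨ ∂αaux-step m i ⟩
      ∂ (X i) * e + f * ∂a m (suc i)                 ≡⟨ cong (λ dx → dx * e + f * ∂a m (suc i)) (∂X-other (ℕₚ.<⇒≢ i<k)) ⟩
      + 0 + f * ∂a m (suc i)                         ≡⟨ ℤₚ.+-identityˡ _ ⟩
      f * ∂a m (suc i)                               ∎
      where
      open ≡-Reasoning
      e = + 1 - + 2 * a m (suc i)
      f = + 1 - + 2 * y i

    ∂αaux-unit : ∀ m i → i ≤ k → k ℕ.< i ℕ.+ m → IsUnit (∂a m i)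
    ∂αaux-unit zero    i i≤k k<i+0 = ⊥-elim (ℕₚ.<⇒≱ k<i+0 (subst (_≤ k) (sym (ℕₚ.+-identityʳ i)) i≤k))
    ∂αaux-unit (suc m) i i≤k k<i+1+m with ℕₚ.m≤n⇒m<n∨m≡n i≤k
    ... | inj₂ refl = subst IsUnit (sym (∂αaux-at m)) (unit-of-bit (αaux-bit m (suc k)))
    ... | inj₁ i<k  = subst IsUnit (sym (∂αaux-below m i i<k))
                            (unit-* (unit-of-bit (y-bit i))
                                    (∂αaux-unit m (suc i) i<k (subst (k ℕ.<_) (ℕₚ.+-suc i m) k<i+1+m)))

    ∂β : ∀ n i → ∂ (β n i) ≡ + (2 ^ i) * ∂ (X i) * (+ 1 - + 2 * y i) * q i
    ∂β n i = begin
      ∂ (β n i)                                              ≡⟨ product-rule c (y i) (∂ (X i)) (q i) (∂ (βtail i)) ⟩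
      c * ∂ (X i) * (+ 1 - + 2 * y i) * q i + (y i - y i * y i) * (c * ∂ (βtail i))
                                                             ≡⟨ cong (λ z → c * ∂ (X i) * (+ 1 - + 2 * y i) * q i + z * (c * ∂ (βtail i))) (bit-x-x²≡0 (y-bit i)) ⟩
      c * ∂ (X i) * (+ 1 - + 2 * y i) * q i + + 0            ≡⟨ ℤₚ.+-identityʳ (c * ∂ (X i) * (+ 1 - + 2 * y i) * q i) ⟩
      c * ∂ (X i) * (+ 1 - + 2 * y i) * q i                  ∎
      where
      open ≡-Reasoning
      c = + (2 ^ i)
      -- the left-hand side is deriv followed by eval, unfolded literally
      product-rule : ∀ c x dx t dt → (+ 0 * (x + - (x * x)) + c * (dx + - (dx * x + x * dx))) * t + (c * (x + - (x * x))) * dt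
                                     ≡ c * dx * (+ 1 - + 2 * x) * t + (x - x * x) * (c * dt)
      product-rule = solve-∀

    ∂β-other : ∀ n {i} → i ≢ k → ∂ (β n i) ≡ + 0
    ∂β-other n {i} i≢k = trans (∂β n i)
      (cong (λ z → z * (+ 1 - + 2 * y i) * q i) (trans (cong (+ (2 ^ i) *_) (∂X-other i≢k)) (ℤₚ.*-zeroʳ (+ (2 ^ i)))))

    ∂β-self : ∀ n → ∂ (β n k) ≡ + (2 ^ k) * ((+ 1 - + 2 * y k) * q k)
    ∂β-self n = begin
      ∂ (β n k)                                              ≡⟨ ∂β n k ⟩
      + (2 ^ k) * ∂ (X k) * (+ 1 - + 2 * y k) * q k          ≡⟨ cong (λ z → z * (+ 1 - + 2 * y k) * q k)
                                                                     (trans (cong (+ (2 ^ k) *_) ∂X-self) (ℤₚ.*-identityʳ (+ (2 ^ k)))) ⟩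
      + (2 ^ k) * (+ 1 - + 2 * y k) * q k                    ≡⟨ ℤₚ.*-assoc (+ (2 ^ k)) _ _ ⟩
      + (2 ^ k) * ((+ 1 - + 2 * y k) * q k)                  ∎
      where open ≡-Reasoning

    term : ℕ → ℕ → Expr
    term n i = con (+ (2 ^ (i ∸ 1))) ⊗ α n i ⊝ β n i

    t : ℕ → ℕ → ℤ
    t n i = ∂ (term n i)

    ∂term : ∀ n i → t n i ≡ + (2 ^ (i ∸ 1)) * ∂a (suc n ∸ i) i - ∂ (β n i)
    ∂term n i = cong (_- ∂ (β n i)) (ℤₚ.+-identityˡ (+ (2 ^ (i ∸ 1)) * ∂a (suc n ∸ i) i))

    ∂term-above : ∀ n {i} → k ℕ.< i → t n i ≡ + 0
    ∂term-above n {i} k<i = begin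
      t n i                                                  ≡⟨ ∂term n i ⟩
      + (2 ^ (i ∸ 1)) * ∂a (suc n ∸ i) i - ∂ (β n i)         ≡⟨ cong₂ (λ u v → + (2 ^ (i ∸ 1)) * u - v)
                                                                      (∂αaux-above (suc n ∸ i) i k<i) (∂β-other n (ℕₚ.>⇒≢ k<i)) ⟩
      + (2 ^ (i ∸ 1)) * + 0 - + 0                            ≡⟨ cong (_- + 0) (ℤₚ.*-zeroʳ (+ (2 ^ (i ∸ 1)))) ⟩
      + 0                                                    ∎
      where open ≡-Reasoning

    ∣∂term-below∣ : ∀ {n i} → i ℕ.< k → k ≤ n → ∣ t n i ∣ ≡ 2 ^ (i ∸ 1)
    ∣∂term-below∣ {n} {i} i<k k≤n = begin
      ∣ t n i ∣                                              ≡⟨ cong ∣_∣ (∂term n i) ⟩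
      ∣ + (2 ^ (i ∸ 1)) * ∂a (suc n ∸ i) i - ∂ (β n i) ∣     ≡⟨ cong (λ v → ∣ + (2 ^ (i ∸ 1)) * ∂a (suc n ∸ i) i - v ∣)
                                                                     (∂β-other n (ℕₚ.<⇒≢ i<k)) ⟩
      ∣ + (2 ^ (i ∸ 1)) * ∂a (suc n ∸ i) i + + 0 ∣           ≡⟨ cong ∣_∣ (ℤₚ.+-identityʳ (+ (2 ^ (i ∸ 1)) * ∂a (suc n ∸ i) i)) ⟩
      ∣ + (2 ^ (i ∸ 1)) * ∂a (suc n ∸ i) i ∣                 ≡⟨ ∣n*unit∣≡n (2 ^ (i ∸ 1)) (∂αaux-unit (suc n ∸ i) i (ℕₚ.<⇒≤ i<k) k<i+[1+n∸i]) ⟩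
      2 ^ (i ∸ 1)                                            ∎
      where
      open ≡-Reasoning
      k<i+[1+n∸i] : k ℕ.< i ℕ.+ (suc n ∸ i)
      k<i+[1+n∸i] = subst (k ℕ.<_) (sym (ℕₚ.m+[n∸m]≡n (ℕₚ.≤-trans (ℕₚ.<⇒≤ i<k) (ℕₚ.m≤n⇒m≤1+n k≤n)))) (ℕ.s≤s k≤n)

    ∂term-at : ∀ {n} → k ≤ n →
               t n k ≡ + (2 ^ (k ∸ 1)) * (+ 1 - + 2 * a (n ∸ k) (suc k)) - + (2 ^ k) * ((+ 1 - + 2 * y k) * q k)
    ∂term-at {n} k≤n = begin
      t n k                                                  ≡⟨ ∂term n k ⟩
      + (2 ^ (k ∸ 1)) * ∂a (suc n ∸ k) k - ∂ (β n k)         ≡⟨ cong₂ (λ m v → + (2 ^ (k ∸ 1)) * ∂a m k - v)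
                                                                      (ℕₚ.+-∸-assoc 1 k≤n) (∂β-self n) ⟩
      + (2 ^ (k ∸ 1)) * ∂a (suc (n ∸ k)) k - + (2 ^ k) * ((+ 1 - + 2 * y k) * q k)
                                                             ≡⟨ cong (λ u → + (2 ^ (k ∸ 1)) * u - _) (∂αaux-at (n ∸ k)) ⟩
      + (2 ^ (k ∸ 1)) * (+ 1 - + 2 * a (n ∸ k) (suc k)) - + (2 ^ k) * ((+ 1 - + 2 * y k) * q k)
                                                             ∎
      where open ≡-Reasoning

    ∂F-decomposition : ∀ {n} → k ≤ n →
      ∂ (F n) ≡ ∑ (interval 1 (pred k)) (t n)
                + (+ (2 ^ (k ∸ 1)) * (+ 1 - + 2 * a (n ∸ k) (suc k)) - + (2 ^ k) * ((+ 1 - + 2 * y k) * q k))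
    ∂F-decomposition {n} k≤n = begin
      ∂ (F n)                                                ≡⟨ eval-deriv-ΣE ρ k 1 n (term n) ⟩
      ∑ (interval 1 n) (t n)                                 ≡⟨ cong (λ is → ∑ is (t n)) (interval-split k≤n) ⟩
      ∑ (interval 1 (pred k) ++ k ∷ interval (suc k) (n ∸ k)) (t n)
                                                             ≡⟨ ∑-++ (interval 1 (pred k)) _ (t n) ⟩
      L + (t n k + ∑ (interval (suc k) (n ∸ k)) (t n))       ≡⟨ cong (λ z → L + (t n k + z))
                                                                     (∑-vanishing (suc k) (n ∸ k) (t n) (λ _ → ∂term-above n)) ⟩
      L + (t n k + + 0)                                      ≡⟨ cong (λ z → L + z) (trans (ℤₚ.+-identityʳ (t n k)) (∂term-at k≤n)) ⟩
      L + (+ (2 ^ (k ∸ 1)) * (+ 1 - + 2 * a (n ∸ k) (suc k)) - + (2 ^ k) * ((+ 1 - + 2 * y k) * q k))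
                                                             ∎
      where
      open ≡-Reasoning
      L = ∑ (interval 1 (pred k)) (t n)

    lower-terms-bound : ∀ {n} → k ≤ n → ∣ ∑ (interval 1 (pred k)) (t n) ∣ ℕ.< 2 ^ pred k
    lower-terms-bound {n} k≤n = ∣∑∣-geometric-bound 0 (pred k) (t n)
      (λ i _ i≤pred[k] → ℕₚ.≤-reflexive (∣∂term-below∣ (ℕₚ.m≤pred[n]⇒suc[m]≤n i≤pred[k]) k≤n))

lemma3 : (n : ℕ) (x : Fin n → Bool) (k : ℕ) → 1 ≤ k → k ≤ n →
    (((+ 0 < ∂F n x k) × (xk x k ≡ + 0)) ⊎ ((∂F n x k < + 0) × (xk x k ≡ + 1)))
    ⇔ (((+ 2) ∣ (s n x k - xk x k)) × (p n x k ≡ + 1))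
lemma3 n x zero     ()
lemma3 n x k@(suc j) _ k≤n =
  (bit-parity⇔ (s n x k) (sE-parity n k) (αaux-bit (n ∸ k) (suc k)) (y-bit k) ×-⇔ ⇔-id _)
    ⇔-∘ sign-criterion (∑ (interval 1 j) (t n)) (2 ^ j) (lower-terms-bound k≤n) (αaux-bit (n ∸ k) (suc k)) (y-bit k)
                       (pE-indicates-βtail n k) (∂F-decomposition k≤n)
  where
  open AtBitPoint (env x) (env-bit x)
  open Derivative k
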